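{- The group $D\curlywedge D$ contains a unique abelian subgroup of order $16$. This subgroup equals $\ker(\lambda_1)\times\ker(\lambda_2)$ and is isomorphic to $(\mathbb Z/2\mathbb Z)^4$.
   Context: $D$ is the dihedral group of order $8$. $\lambda_1,\lambda_2:D\to\mathbb Z/2\mathbb Z$ are homomorphisms each with kernel isomorphic to $\mathbb Z/2\mathbb Z\times\mathbb Z/2\mathbb Z$, and $D\curlywedge D=\{(u,v)\in D\times D:\lambda_1(u)=\lambda_2(v)\}$. -}

module Defs where

open import Data.Bool using (Bool; true; false; _xor_; _∧_; not)
open import Data.Nat using (ℕ; _+_; _∸_)
open import Data.Nat.DivMod using (_%_; m%n<n)
open import Data.Fin using (Fin; toℕ; fromℕ<; zero)
open import Data.Product using (_×_; _,_; proj₁; proj₂; Σ; ∃)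
open import Data.List using (List; length; filter; allFin; cartesianProduct; _∷_; [])
open import Data.Vec using (Vec; zipWith)
open import Function using (_⇔_)
open import Function.Definitions using (Injective)
open import Relation.Binary.PropositionalEquality using (_≡_)
open import Relation.Nullary.Decidable using (Dec)
open import Data.Bool.Properties using (_≟_)

-- Z/2Z is modelled as Bool with addition _xor_ (identity false).

-- The dihedral group of order 8:  r^i s^a  is represented by (i , a),
-- i ∈ Z/4, a ∈ Bool.  Relations: r^4 = s^2 = 1, s r s = r^{-1}.
-- (r^i s^a)(r^j s^b) = r^{i + (-1)^a j} s^{a + b}.

add4 : Fin 4 → Fin 4 → Fin 4
add4 i j = fromℕ< (m%n<n (toℕ i + toℕ j) 4)

neg4 : Fin 4 → Fin 4
neg4 i = fromℕ< (m%n<n (4 ∸ toℕ i) 4)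

D : Set
D = Fin 4 × Bool

_·_ : D → D → D
(i , false) · (j , b) = (add4 i j , b)
(i , true)  · (j , b) = (add4 i (neg4 j) , not b)

e : D
e = (zero , false)

inv : D → D
inv (i , false) = (neg4 i , false)
inv (i , true)  = (i , true)

elemsD : List D
elemsD = cartesianProduct (allFin 4) (true ∷ false ∷ [])

_⊙_ : D × D → D × D → D × D
(u , v) ⊙ (u' , v') = (u · u' , v · v')

e² : D × D
e² = (e , e)

inv² : D × D → D × D
inv² (u , v) = (inv u , inv v)

elemsDD : List (D × D)
elemsDD = cartesianProduct elemsD elemsD

IsHomToZ2 : (D → Bool) → Set
IsHomToZ2 λ' = ∀ x y → λ' (x · y) ≡ (λ' x xor λ' y)

V4 : Set
V4 = Bool × Bool

_⊕V_ : V4 → V4 → V4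
(a , b) ⊕V (c , d) = (a xor c , b xor d)

KernelIsKlein : (D → Bool) → Set
KernelIsKlein λ' =
  Σ (V4 → D) λ g →
    (∀ x y → g (x ⊕V y) ≡ (g x · g y)) ×
    Injective _≡_ _≡_ g ×
    (∀ u → (λ' u ≡ false) ⇔ (∃ λ x → g x ≡ u))

-- The fibre product  D ⋏ D = {(u,v) : λ₁ u = λ₂ v}

InFibre : (D → Bool) → (D → Bool) → D × D → Set
InFibre λ₁ λ₂ (u , v) = λ₁ u ≡ λ₂ v

record IsSubgroupOfFibre (λ₁ λ₂ : D → Bool) (H : D × D → Bool) : Set where
  field
    inFibre : ∀ x → H x ≡ true → InFibre λ₁ λ₂ x
    hasOne  : H e² ≡ true
    closed· : ∀ x y → H x ≡ true → H y ≡ true → H (x ⊙ y) ≡ true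
    closedInv : ∀ x → H x ≡ true → H (inv² x) ≡ true

IsAbelianSubset : (D × D → Bool) → Set
IsAbelianSubset H = ∀ x y → H x ≡ true → H y ≡ true → (x ⊙ y) ≡ (y ⊙ x)

order : (D × D → Bool) → ℕ
order H = length (filter (λ x → H x ≟ true) elemsDD)

kerProd : (D → Bool) → (D → Bool) → D × D → Bool
kerProd λ₁ λ₂ (u , v) = not (λ₁ u) ∧ not (λ₂ v)

Z2⁴ : Set
Z2⁴ = Vec Bool 4

_⊕⁴_ : Z2⁴ → Z2⁴ → Z2⁴
_⊕⁴_ = zipWith _xor_

IsoToZ2⁴ : (D × D → Bool) → Set
IsoToZ2⁴ H =
  Σ (Z2⁴ → D × D) λ f →
    (∀ x y → f (x ⊕⁴ y) ≡ (f x ⊙ f y)) ×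
    Injective _≡_ _≡_ f ×
    (∀ w → (H w ≡ true) ⇔ (∃ λ x → f x ≡ w))

{-# OPTIONS --safe #-}
-- A homomorphism D → Z/2 whose kernel is a Klein four-group cannot kill the
-- rotation r (of order 4), so it is one of the two maps r^i s^a ↦ i + t a,
-- and all remaining claims become finite computations. Both of these kernels
-- are abelian, so ker λ₁ × ker λ₂ is an abelian subgroup of D ⋏ D of order 16,
-- and the given Klein isomorphisms assemble to (Z/2)^4 ≅ ker λ₁ × ker λ₂.
-- Conversely, an element (a , b) of D ⋏ D outside ker λ₁ × ker λ₂ has
-- non-central coordinates and its centraliser in D ⋏ D has only 8 elements;
-- hence an abelian subgroup of order 16 lies in ker λ₁ × ker λ₂, and equals
-- it by counting.
module Submission where

open import Defs
open import Data.Bool using (Bool; true; false; _xor_; _∧_; not)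
open import Data.Bool.Properties using (_≟_; xor-same; ¬-not)
open import Data.Fin using (Fin; zero; suc)
import Data.Fin.Properties as Fin
open import Data.List using (List; []; _∷_; length; filter)
open import Data.List.Membership.Propositional using (_∈_)
open import Data.List.Membership.Propositional.Properties
  using (∈-filter⁺; ∈-filter⁻; ∈-cartesianProduct⁺; ∈-allFin)
open import Data.List.Relation.Binary.Pointwise using (Pointwise-≡⇒≡)
open import Data.List.Relation.Binary.Sublist.Propositional using (_⊆_; ⊆-refl)
open import Data.List.Relation.Binary.Sublist.Propositional.Properties
  using (filter⁺; length-mono-≤; to-≋)
import Data.List.Relation.Unary.All as All
open import Data.List.Relation.Unary.Any using (here; there)
open import Data.Nat using (ℕ; _≤_; _<_)
import Data.Nat.Properties as ℕ
open import Data.Product using (_×_; _,_; proj₁; proj₂; ∃)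
open import Data.Product.Properties using (≡-dec)
open import Data.Vec using ([]; _∷_)
open import Function using (_⇔_; mk⇔; Equivalence)
open import Function.Definitions using (Injective)
open import Relation.Binary.Definitions using (DecidableEquality)
open import Relation.Binary.PropositionalEquality
  using (_≡_; refl; sym; trans; cong; cong₂; subst; _≗_; module ≡-Reasoning)
open import Relation.Nullary.Decidable
  using (Dec; yes; no; does; map′; from-yes; dec-true; _→-dec_)
open import Relation.Nullary.Negation using (contradiction)
open import Relation.Unary using (Decidable)

module _ {A : Set} where

  _⊆ᵇ_ : (A → Bool) → (A → Bool) → Set
  P ⊆ᵇ Q = ∀ x → P x ≡ true → Q x ≡ true

  countᵇ : (A → Bool) → List A → ℕ
  countᵇ P xs = length (filter (λ x → P x ≟ true) xs)

  private
    filter-mono : ∀ {P Q} xs → P ⊆ᵇ Q →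
                  filter (λ x → P x ≟ true) xs ⊆ filter (λ x → Q x ≟ true) xs
    filter-mono {P} {Q} xs P⊆Q =
      filter⁺ (λ x → P x ≟ true) (λ x → Q x ≟ true) (λ { refl → P⊆Q _ }) (⊆-refl {x = xs})

  countᵇ-mono : ∀ {P Q} xs → P ⊆ᵇ Q → countᵇ P xs ≤ countᵇ Q xs
  countᵇ-mono xs P⊆Q = length-mono-≤ (filter-mono xs P⊆Q)

  countᵇ-cong : ∀ {P Q} xs → P ≗ Q → countᵇ P xs ≡ countᵇ Q xs
  countᵇ-cong xs P≗Q = ℕ.≤-antisym
    (countᵇ-mono xs λ x → subst (_≡ true) (P≗Q x))
    (countᵇ-mono xs λ x → subst (_≡ true) (sym (P≗Q x)))

  countᵇ-≡⇒≗ : ∀ {P Q} xs → P ⊆ᵇ Q → countᵇ P xs ≡ countᵇ Q xs →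
               ∀ {x} → x ∈ xs → P x ≡ Q x
  countᵇ-≡⇒≗ {P} {Q} xs P⊆Q |P|≡|Q| {x} x∈xs = ⇔true⇒≡ (P⊆Q x) Q⇒P
    where
    filterP≡filterQ : filter (λ y → P y ≟ true) xs ≡ filter (λ y → Q y ≟ true) xs
    filterP≡filterQ = Pointwise-≡⇒≡ (to-≋ |P|≡|Q| (filter-mono xs P⊆Q))

    Q⇒P : Q x ≡ true → P x ≡ true
    Q⇒P Qx = proj₂ (∈-filter⁻ (λ y → P y ≟ true) {xs = xs}
                      (subst (x ∈_) (sym filterP≡filterQ) (∈-filter⁺ (λ y → Q y ≟ true) x∈xs Qx)))

    ⇔true⇒≡ : ∀ {a b} → (a ≡ true → b ≡ true) → (b ≡ true → a ≡ true) → a ≡ b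
    ⇔true⇒≡ {false} {false} _   _   = refl
    ⇔true⇒≡ {false} {true}  _   b⇒a = b⇒a refl
    ⇔true⇒≡ {true}  {false} a⇒b _   = sym (a⇒b refl)
    ⇔true⇒≡ {true}  {true}  _   _   = refl

module _ {A : Set} {xs : List A} (xs-complete : ∀ x → x ∈ xs) where

  all?-by-enumeration : {P : A → Set} → Decidable P → Dec (∀ x → P x)
  all?-by-enumeration P? = map′
    (λ all x → All.lookup all (xs-complete x))
    (λ all → All.tabulate λ {x} _ → all x)
    (All.all? P? xs)

∈-bools : ∀ b → b ∈ true ∷ false ∷ []
∈-bools true  = here refl
∈-bools false = there (here refl)

all-Bool? : {P : Bool → Set} → Decidable P → Dec (∀ b → P b)
all-Bool? = all?-by-enumeration ∈-bools

∈-elemsD : ∀ u → u ∈ elemsD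
∈-elemsD (i , a) = ∈-cartesianProduct⁺ (∈-allFin i) (∈-bools a)

∈-elemsDD : ∀ x → x ∈ elemsDD
∈-elemsDD (u , v) = ∈-cartesianProduct⁺ (∈-elemsD u) (∈-elemsD v)

all-D? : {P : D → Set} → Decidable P → Dec (∀ u → P u)
all-D? = all?-by-enumeration ∈-elemsD

infix 4 _≟ᴰ_ _≟ᴰ²_

_≟ᴰ_ : DecidableEquality D
_≟ᴰ_ = ≡-dec Fin._≟_ _≟_

_≟ᴰ²_ : DecidableEquality (D × D)
_≟ᴰ²_ = ≡-dec _≟ᴰ_ _≟ᴰ_

variable
  u v : D

r s : D
r = (suc zero , false)
s = (zero , true)

rotation·reflection : ∀ i a → (i , false) · (zero , a) ≡ (i , a)
rotation·reflection zero                   a = refl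
rotation·reflection (suc zero)             a = refl
rotation·reflection (suc (suc zero))       a = refl
rotation·reflection (suc (suc (suc zero))) a = refl

idempotent⇒e : ∀ u → u · u ≡ u → u ≡ e
idempotent⇒e = from-yes (all-D? λ u → (u · u ≟ᴰ u) →-dec (u ≟ᴰ e))

·-inverseʳ : ∀ u → u · inv u ≡ e
·-inverseʳ = from-yes (all-D? λ u → u · inv u ≟ᴰ e)

module _ (λ' : D → Bool) (hom : IsHomToZ2 λ') where
  open ≡-Reasoning

  hom-e : λ' e ≡ false
  hom-e = trans (hom e e) (xor-same (λ' e))

  ker-· : λ' u ≡ false → λ' v ≡ false → λ' (u · v) ≡ false
  ker-· {u} {v} λ'u λ'v = trans (hom u v) (cong₂ _xor_ λ'u λ'v)

  ker-inv : λ' u ≡ false → λ' (inv u) ≡ false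
  ker-inv {u} λ'u = begin
    λ' (inv u)           ≡⟨ cong (_xor λ' (inv u)) λ'u ⟨
    λ' u xor λ' (inv u)  ≡⟨ hom u (inv u) ⟨
    λ' (u · inv u)       ≡⟨ cong λ' (·-inverseʳ u) ⟩
    λ' e                 ≡⟨ hom-e ⟩
    false                ∎

module _ (λ₁ λ₂ : D → Bool) where

  kerProd-intro : λ₁ u ≡ false → λ₂ v ≡ false → kerProd λ₁ λ₂ (u , v) ≡ true
  kerProd-intro λ₁u λ₂v = cong₂ (λ a b → not a ∧ not b) λ₁u λ₂v

  kerProd-elim : kerProd λ₁ λ₂ (u , v) ≡ true → λ₁ u ≡ false × λ₂ v ≡ false
  kerProd-elim {u} {v} h with λ₁ u | λ₂ v
  kerProd-elim refl | false | false = refl , refl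

kerProd-isSubgroupOfFibre : ∀ {λ₁ λ₂} → IsHomToZ2 λ₁ → IsHomToZ2 λ₂ →
                            IsSubgroupOfFibre λ₁ λ₂ (kerProd λ₁ λ₂)
kerProd-isSubgroupOfFibre {λ₁} {λ₂} hom₁ hom₂ = record
  { inFibre   = λ (u , v) h → let λ₁u , λ₂v = kerProd-elim λ₁ λ₂ h in trans λ₁u (sym λ₂v)
  ; hasOne    = kerProd-intro λ₁ λ₂ (hom-e λ₁ hom₁) (hom-e λ₂ hom₂)
  ; closed·   = λ (u , v) (u' , v') h h' →
      let λ₁u , λ₂v = kerProd-elim λ₁ λ₂ h ; λ₁u' , λ₂v' = kerProd-elim λ₁ λ₂ h'
      in kerProd-intro λ₁ λ₂ (ker-· λ₁ hom₁ λ₁u λ₁u') (ker-· λ₂ hom₂ λ₂v λ₂v')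
  ; closedInv = λ (u , v) h →
      let λ₁u , λ₂v = kerProd-elim λ₁ λ₂ h
      in kerProd-intro λ₁ λ₂ (ker-inv λ₁ hom₁ λ₁u) (ker-inv λ₂ hom₂ λ₂v)
  }

parity : Fin 4 → Bool
parity zero                   = false
parity (suc zero)             = true
parity (suc (suc zero))       = false
parity (suc (suc (suc zero))) = true

kleinHom : Bool → D → Bool
kleinHom t (i , a) = parity i xor (a ∧ t)

kleinImage-square : (g : V4 → D) → (∀ x y → g (x ⊕V y) ≡ g x · g y) →
                    ∀ x → g x · g x ≡ e
kleinImage-square g g-hom x@(a , b) = begin
  g x · g x          ≡⟨ g-hom x x ⟨
  g (x ⊕V x)         ≡⟨ cong g (cong₂ _,_ (xor-same a) (xor-same b)) ⟩
  g (false , false)  ≡⟨ idempotent⇒e _ (sym (g-hom (false , false) (false , false))) ⟩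
  e                  ∎
  where open ≡-Reasoning

-- r has order 4, so it cannot lie in a Klein four-group.
kleinKernel⇒r∉ker : (λ' : D → Bool) → KernelIsKlein λ' → λ' r ≡ true
kleinKernel⇒r∉ker λ' (g , g-hom , _ , g-image) with λ' r ≟ true
... | yes λ'r = λ'r
... | no  λ'r≢true with x , gx≡r ← Equivalence.to (g-image r) (¬-not λ'r≢true) =
  contradiction (subst (λ u → u · u ≡ e) gx≡r (kleinImage-square g g-hom x)) λ ()

module _ (λ' : D → Bool) (hom : IsHomToZ2 λ') where

  hom-rotation : λ' r ≡ true → ∀ i → λ' (i , false) ≡ parity i
  hom-rotation λ'r zero                   = hom-e λ' hom
  hom-rotation λ'r (suc zero)             = λ'r
  hom-rotation λ'r (suc (suc zero))       = trans (hom r r) (cong₂ _xor_ λ'r λ'r)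
  hom-rotation λ'r (suc (suc (suc zero))) =
    trans (hom (suc (suc zero) , false) r) (cong₂ _xor_ (hom-rotation λ'r (suc (suc zero))) λ'r)

  hom-reflection : ∀ a → λ' (zero , a) ≡ a ∧ λ' s
  hom-reflection false = hom-e λ' hom
  hom-reflection true  = refl

  kleinKernel⇒≗kleinHom : KernelIsKlein λ' → λ' ≗ kleinHom (λ' s)
  kleinKernel⇒≗kleinHom klein (i , a) = begin
    λ' (i , a)                        ≡⟨ cong λ' (rotation·reflection i a) ⟨
    λ' ((i , false) · (zero , a))     ≡⟨ hom (i , false) (zero , a) ⟩
    λ' (i , false) xor λ' (zero , a)  ≡⟨ cong₂ _xor_ (hom-rotation (kleinKernel⇒r∉ker λ' klein) i)
                                                     (hom-reflection a) ⟩
    parity i xor (a ∧ λ' s)           ∎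
    where open ≡-Reasoning

fibreCentraliser : (D → Bool) → (D → Bool) → D × D → D × D → Bool
fibreCentraliser λ₁ λ₂ x (u , v) = does (λ₁ u ≟ λ₂ v) ∧ does (x ⊙ (u , v) ≟ᴰ² (u , v) ⊙ x)

kleinHom-ker-comm : ∀ t u v → kleinHom t u ≡ false → kleinHom t v ≡ false → u · v ≡ v · u
kleinHom-ker-comm = from-yes (all-Bool? λ t → all-D? λ u → all-D? λ v →
  (kleinHom t u ≟ false) →-dec (kleinHom t v ≟ false) →-dec (u · v ≟ᴰ v · u))

order-kerProd-kleinHom : ∀ t₁ t₂ → order (kerProd (kleinHom t₁) (kleinHom t₂)) ≡ 16
order-kerProd-kleinHom = from-yes (all-Bool? λ t₁ → all-Bool? λ t₂ →
  order (kerProd (kleinHom t₁) (kleinHom t₂)) ℕ.≟ 16)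

order-fibreCentraliser-kleinHom :
  ∀ t₁ t₂ a b → kleinHom t₁ a ≡ true → kleinHom t₂ b ≡ true →
  order (fibreCentraliser (kleinHom t₁) (kleinHom t₂) (a , b)) ≡ 8
order-fibreCentraliser-kleinHom = from-yes (all-Bool? λ t₁ → all-Bool? λ t₂ →
  all-D? λ a → all-D? λ b →
  (kleinHom t₁ a ≟ true) →-dec (kleinHom t₂ b ≟ true) →-dec
  (order (fibreCentraliser (kleinHom t₁) (kleinHom t₂) (a , b)) ℕ.≟ 8))

order-≡⇒≗ : ∀ {H K : D × D → Bool} → H ⊆ᵇ K → order H ≡ order K → H ≗ K
order-≡⇒≗ H⊆K |H|≡|K| x = countᵇ-≡⇒≗ elemsDD H⊆K |H|≡|K| (∈-elemsDD x)

abelian⊆fibreCentraliser : ∀ λ₁ λ₂ {H x} → (∀ y → H y ≡ true → InFibre λ₁ λ₂ y) →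
                           IsAbelianSubset H → H x ≡ true → H ⊆ᵇ fibreCentraliser λ₁ λ₂ x
abelian⊆fibreCentraliser λ₁ λ₂ inFibre abelian Hx (u , v) Hy =
  cong₂ _∧_ (dec-true (λ₁ u ≟ λ₂ v) (inFibre _ Hy)) (dec-true (_ ≟ᴰ² _) (abelian _ _ Hx Hy))

module _ {λ₁ λ₂ : D → Bool} {t₁ t₂ : Bool}
         (λ₁≗ : λ₁ ≗ kleinHom t₁) (λ₂≗ : λ₂ ≗ kleinHom t₂) where

  kerProd-abelian : IsAbelianSubset (kerProd λ₁ λ₂)
  kerProd-abelian (u , v) (u' , v') h h' =
    let λ₁u , λ₂v = kerProd-elim λ₁ λ₂ h ; λ₁u' , λ₂v' = kerProd-elim λ₁ λ₂ h'
    in cong₂ _,_ (kleinHom-ker-comm t₁ u u' (trans (sym (λ₁≗ u)) λ₁u) (trans (sym (λ₁≗ u')) λ₁u'))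
                 (kleinHom-ker-comm t₂ v v' (trans (sym (λ₂≗ v)) λ₂v) (trans (sym (λ₂≗ v')) λ₂v'))

  order-kerProd : order (kerProd λ₁ λ₂) ≡ 16
  order-kerProd = trans
    (countᵇ-cong elemsDD λ (u , v) → cong₂ (λ a b → not a ∧ not b) (λ₁≗ u) (λ₂≗ v))
    (order-kerProd-kleinHom t₁ t₂)

  order-fibreCentraliser : ∀ {a b} → λ₁ a ≡ true → λ₂ b ≡ true →
                           order (fibreCentraliser λ₁ λ₂ (a , b)) ≡ 8
  order-fibreCentraliser {a} {b} λ₁a λ₂b = trans
    (countᵇ-cong elemsDD λ (u , v) → cong₂ (λ c d → does (c ≟ d) ∧ _) (λ₁≗ u) (λ₂≗ v))
    (order-fibreCentraliser-kleinHom t₁ t₂ a b (trans (sym (λ₁≗ a)) λ₁a) (trans (sym (λ₂≗ b)) λ₂b))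

  abelian⊆kerProd : ∀ {H} → (∀ x → H x ≡ true → InFibre λ₁ λ₂ x) → IsAbelianSubset H →
                    8 < order H → H ⊆ᵇ kerProd λ₁ λ₂
  abelian⊆kerProd {H} inFibre abelian 8<|H| (a , b) Hab with λ₁ a ≟ true
  ... | no λ₁a≢true =
    let λ₁a = ¬-not λ₁a≢true in kerProd-intro λ₁ λ₂ λ₁a (trans (sym (inFibre _ Hab)) λ₁a)
  ... | yes λ₁a = contradiction 8<|H| (ℕ.≤⇒≯ (begin
    order H                                 ≤⟨ countᵇ-mono elemsDD
                                                 (abelian⊆fibreCentraliser λ₁ λ₂ inFibre abelian Hab) ⟩
    order (fibreCentraliser λ₁ λ₂ (a , b))  ≡⟨ order-fibreCentraliser λ₁a (trans (sym (inFibre _ Hab)) λ₁a) ⟩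
    8                                       ∎))
    where open ℕ.≤-Reasoning

kerProd≅Z2⁴ : ∀ λ₁ λ₂ → KernelIsKlein λ₁ → KernelIsKlein λ₂ → IsoToZ2⁴ (kerProd λ₁ λ₂)
kerProd≅Z2⁴ λ₁ λ₂ (g₁ , g₁-hom , g₁-inj , g₁-image) (g₂ , g₂-hom , g₂-inj , g₂-image) =
  f , f-hom , f-inj , f-image
  where
  f : Z2⁴ → D × D
  f (a ∷ b ∷ c ∷ d ∷ []) = g₁ (a , b) , g₂ (c , d)

  f-hom : ∀ x y → f (x ⊕⁴ y) ≡ f x ⊙ f y
  f-hom (a ∷ b ∷ c ∷ d ∷ []) (a' ∷ b' ∷ c' ∷ d' ∷ []) =
    cong₂ _,_ (g₁-hom (a , b) (a' , b')) (g₂-hom (c , d) (c' , d'))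

  f-inj : Injective _≡_ _≡_ f
  f-inj {a ∷ b ∷ c ∷ d ∷ []} {a' ∷ b' ∷ c' ∷ d' ∷ []} fx≡fy
    with refl ← g₁-inj (cong proj₁ fx≡fy) | refl ← g₂-inj (cong proj₂ fx≡fy) = refl

  f-image : ∀ w → (kerProd λ₁ λ₂ w ≡ true) ⇔ (∃ λ x → f x ≡ w)
  f-image (u , v) = mk⇔ to from
    where
    to : kerProd λ₁ λ₂ (u , v) ≡ true → ∃ λ x → f x ≡ (u , v)
    to h =
      let λ₁u , λ₂v         = kerProd-elim λ₁ λ₂ h
          (a , b) , g₁ab≡u = Equivalence.to (g₁-image u) λ₁u
          (c , d) , g₂cd≡v = Equivalence.to (g₂-image v) λ₂v
      in (a ∷ b ∷ c ∷ d ∷ []) , cong₂ _,_ g₁ab≡u g₂cd≡v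

    from : (∃ λ x → f x ≡ (u , v)) → kerProd λ₁ λ₂ (u , v) ≡ true
    from ((a ∷ b ∷ c ∷ d ∷ []) , fx≡uv) = kerProd-intro λ₁ λ₂
      (Equivalence.from (g₁-image u) ((a , b) , cong proj₁ fx≡uv))
      (Equivalence.from (g₂-image v) ((c , d) , cong proj₂ fx≡uv))

proposition4p2 : (λ₁ λ₂ : D → Bool) →
    IsHomToZ2 λ₁ → IsHomToZ2 λ₂ → KernelIsKlein λ₁ → KernelIsKlein λ₂ →
    -- existence: ker λ₁ × ker λ₂ is an abelian subgroup of D ⋏ D of order 16
    (IsSubgroupOfFibre λ₁ λ₂ (kerProd λ₁ λ₂) × IsAbelianSubset (kerProd λ₁ λ₂) × order (kerProd λ₁ λ₂) ≡ 16)
    -- uniqueness: every abelian subgroup of D ⋏ D of order 16 equals it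
    × (∀ H → IsSubgroupOfFibre λ₁ λ₂ H → IsAbelianSubset H → order H ≡ 16 → ∀ x → H x ≡ kerProd λ₁ λ₂ x)
    -- and it is isomorphic to (Z/2)^4
    × IsoToZ2⁴ (kerProd λ₁ λ₂)
proposition4p2 λ₁ λ₂ hom₁ hom₂ klein₁ klein₂ =
    (kerProd-isSubgroupOfFibre hom₁ hom₂ , kerProd-abelian λ₁≗ λ₂≗ , order-kerProd λ₁≗ λ₂≗)
  , unique
  , kerProd≅Z2⁴ λ₁ λ₂ klein₁ klein₂
  where
  λ₁≗ : λ₁ ≗ kleinHom (λ₁ s)
  λ₁≗ = kleinKernel⇒≗kleinHom λ₁ hom₁ klein₁

  λ₂≗ : λ₂ ≗ kleinHom (λ₂ s)
  λ₂≗ = kleinKernel⇒≗kleinHom λ₂ hom₂ klein₂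

  unique : ∀ H → IsSubgroupOfFibre λ₁ λ₂ H → IsAbelianSubset H → order H ≡ 16 →
           ∀ x → H x ≡ kerProd λ₁ λ₂ x
  unique H subgroup abelian |H|≡16 = order-≡⇒≗
    (abelian⊆kerProd λ₁≗ λ₂≗ (IsSubgroupOfFibre.inFibre subgroup) abelian
                     (subst (8 <_) (sym |H|≡16) (from-yes (8 ℕ.<? 16))))
    (trans |H|≡16 (sym (order-kerProd λ₁≗ λ₂≗)))
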